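{- (Extension Lemma.) Let $G$ be a chordal graph that does not contain $\mathcal H$ as an induced minor, and let $(C,A)$ be a side of $G$ with $A$ finite. Then for each vertex $v_*\in V(C)$ there exists a finite clique $B\supseteq A$ of $G$ such that either $v_*\in B$, or the unique component of $G-B$ containing $v_*$ is unattached to $A$.
   Context: A graph is chordal if it has no induced cycle of length at least four. $\mathcal H$ denotes the graph obtained from an infinite clique by adding two non-adjacent vertices each adjacent to all vertices of the clique; $H$ is an induced minor of $G$ if there are disjoint connected subgraphs $B_v\subseteq G$ ($v\in V(H)$) such that for distinct $u,v$ there is a $B_u$–$B_v$ edge in $G$ precisely when $uv\in E(H)$. For $S\subseteq V(G)$, a component $D$ of $G-S$ is attached to a set $A\subseteq S$ if $A\subseteq N(D)$, and unattached to $A$ if $A\setminus N(D)\neq\emptyset$, where $N(D)$ is the set of vertices outside $D$ with a neighbour in $D$. A side of $G$ is a pair $(C,S)$ where $S\subseteq V(G)$ is a clique and $C$ is a component of $G-S$ attached to $S$; it is finite if $S$ is finite. -}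

module Defs where

open import Data.Nat using (ℕ; zero; suc; _≤_)
open import Data.Fin using (Fin; toℕ)
open import Data.Product using (Σ; Σ-syntax; ∃; _×_; _,_)
open import Data.Sum using (_⊎_)
open import Data.List using (List)
open import Data.List.Membership.Propositional using (_∈_)
open import Data.Empty using (⊥)
open import Data.Unit using (⊤)
open import Relation.Nullary using (¬_; Dec)
open import Relation.Binary.PropositionalEquality using (_≡_; _≢_)
open import Function.Definitions using (Injective)
open import Function.Bundles using (_⇔_)

Classical : Set₁
Classical = (P : Set) → Dec P

record Graph : Set₁ where
  field
    V       : Set
    E       : V → V → Set
    E-sym   : ∀ {x y} → E x y → E y x
    E-irrefl : ∀ {x} → ¬ E x x
open Graph public

module _ (G : Graph) where

  VSet : Set₁
  VSet = V G → Set

  -- Walks inside an allowed vertex set P (i.e. connectivity in G[P]).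
  data Conn (P : VSet) : V G → V G → Set where
    here : ∀ {x} → P x → Conn P x x
    step : ∀ {x y z} → Conn P x y → E G y z → P z → Conn P x z

  -- The component of G - S containing x (as a vertex set).
  Comp : VSet → V G → VSet
  Comp S x = Conn (λ z → ¬ S z) x

  Nbhd : VSet → VSet
  Nbhd D a = ¬ D a × Σ[ y ∈ V G ] (D y × E G a y)

  Attached : VSet → VSet → Set
  Attached D A = ∀ a → A a → Nbhd D a

  Unattached : VSet → VSet → Set
  Unattached D A = Σ[ a ∈ V G ] (A a × ¬ Nbhd D a)

  IsClique : VSet → Set
  IsClique S = ∀ x y → S x → S y → x ≢ y → E G x y


  IsConnectedSet : VSet → Set
  IsConnectedSet B = Σ[ x ∈ V G ] B x × (∀ x y → B x → B y → Conn B x y)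

-- Finite vertex sets given by lists.
⟦_⟧ : {G : Graph} → List (V G) → VSet G
⟦ L ⟧ x = x ∈ L

-- Cyclic adjacency on Fin n (vertices of the cycle C_n).
CycAdj : (n : ℕ) → Fin n → Fin n → Set
CycAdj n i j = (suc (toℕ i) ≡ toℕ j) ⊎ (suc (toℕ j) ≡ toℕ i)
             ⊎ (toℕ i ≡ 0 × suc (toℕ j) ≡ n) ⊎ (toℕ j ≡ 0 × suc (toℕ i) ≡ n)

Chordal : Graph → Set
Chordal G = ∀ n → 4 ≤ n → (f : Fin n → V G) → Injective _≡_ _≡_ f →
            ¬ (∀ i j → E G (f i) (f j) ⇔ CycAdj n i j)

-- The graph 𝓗: an infinite clique (indexed by ℕ) plus two non-adjacent
-- vertices each adjacent to all vertices of the clique.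
data HV : Set where
  cl  : ℕ → HV
  top : HV
  bot : HV

HE : HV → HV → Set
HE (cl i) (cl j) = i ≢ j
HE (cl _) top = ⊤
HE (cl _) bot = ⊤
HE top (cl _) = ⊤
HE bot (cl _) = ⊤
HE top top = ⊥
HE top bot = ⊥
HE bot top = ⊥
HE bot bot = ⊥

record HInducedMinor (G : Graph) : Set₁ where
  field
    branch    : HV → VSet G
    connected : ∀ h → IsConnectedSet G (branch h)
    disjoint  : ∀ h h' → h ≢ h' → ∀ x → branch h x → ¬ branch h' x
    edges     : ∀ h h' → h ≢ h' →
                (Σ[ x ∈ V G ] Σ[ y ∈ V G ] (branch h x × branch h' y × E G x y))
                ⇔ HE h h'

{-# OPTIONS --safe #-}
-- If v is complete to A, take B = A ∪ {v}. Otherwise let D be the component of v in G − (A ∪ M),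
-- where M is the set of vertices complete to A, and let S be the set of vertices of M with a
-- neighbour in D. Chordality enters through one fact: if s ≁ t and s = q₀, q₁, …, qₘ = t is an
-- induced path, then every common neighbour w of s and t off the path sees q₁, for otherwise
-- w, q₀, …, qₖ with k > 1 least such that w ~ qₖ is a hole. Applied to induced paths through D,
-- it shows that some a ∈ A has no neighbour in D (else D would contain a vertex complete to A,
-- that is, a vertex of M) and that S is a clique (else the second vertex of an induced path
-- through D between two non-adjacent vertices of S would lie in M). If S is finite, B = A ∪ S
-- works: the component of v in G − B stays inside D, so a has no neighbour in it. If S is
-- infinite, infinitely many of its vertices, together with {a} and D, form 𝓗 as an induced minor.
module Submission where

open import Defs
open import Data.Empty using (⊥; ⊥-elim)
open import Data.Fin using (toℕ)
open import Data.Fin.Properties using (toℕ-injective; toℕ<n)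
open import Data.List using (List; []; _∷_; _++_; filter)
open import Data.List.Membership.Propositional using (_∈_; _∉_)
open import Data.List.Membership.Propositional.Properties using (∈-++⁺ˡ; ∈-++⁺ʳ; ∈-++⁻; ∈-filter⁺; ∈-filter⁻)
open import Data.List.Relation.Unary.Any using (here; there)
open import Data.Nat using (ℕ; zero; suc; _+_; _∸_; _≤_; _<_; _≤?_; z≤n; s≤s; z<s)
open import Data.Nat.Induction using (<-rec)
open import Data.Nat.Properties
open import Data.Product using (Σ-syntax; _×_; _,_; proj₁; proj₂)
open import Data.Sum using (_⊎_; inj₁; inj₂; [_,_]′)
open import Function using (_∘_; const)
open import Function.Bundles using (_⇔_; mk⇔; Equivalence)
open import Function.Definitions using (Injective)
open import Relation.Binary.Definitions using (tri<; tri≈; tri>)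
open import Relation.Binary.PropositionalEquality using (_≡_; _≢_; refl; sym; trans; cong; subst; subst₂)
open import Relation.Nullary using (¬_; Dec; yes; no)
open import Relation.Nullary.Decidable using (decidable-stable)

module _ (lem : Classical) where

  least-witness : (P : ℕ → Set) → ∀ {n} → P n → Σ[ m ∈ ℕ ] P m × (∀ {k} → k < m → ¬ P k)
  least-witness P {n} = <-rec (λ n → P n → Least) search n
    where
    Least : Set
    Least = Σ[ m ∈ ℕ ] P m × (∀ {k} → k < m → ¬ P k)
    search : ∀ n → (∀ {k} → k < n → P k → Least) → P n → Least
    search n smaller pn with lem (Σ[ k ∈ ℕ ] k < n × P k)
    ... | yes (k , k<n , pk) = smaller k<n pk
    ... | no none = n , pn , λ k<n pk → none (_ , k<n , pk)

  injective-sequence : {X : Set} (S : X → Set) → ¬ (Σ[ L ∈ List X ] (∀ {x} → S x → x ∈ L)) →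
                       Σ[ f ∈ (ℕ → X) ] (∀ n → S (f n)) × Injective _≡_ _≡_ f
  injective-sequence {X} S unbounded = f , (λ n → proj₁ (proj₂ (fresh (chosen n)))) , f-injective
    where
    fresh : (L : List X) → Σ[ x ∈ X ] S x × x ∉ L
    fresh L = decidable-stable (lem _) λ none →
      unbounded (L , λ {x} Sx → decidable-stable (lem _) λ x∉L → none (x , Sx , x∉L))
    chosen : ℕ → List X
    chosen zero    = []
    chosen (suc n) = proj₁ (fresh (chosen n)) ∷ chosen n
    f : ℕ → X
    f n = proj₁ (fresh (chosen n))
    chosen-before : ∀ {i j} → i < j → f i ∈ chosen j
    chosen-before {i} {suc j} (s≤s i≤j) with m≤n⇒m<n∨m≡n i≤j
    ... | inj₁ i<j  = there (chosen-before i<j)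
    ... | inj₂ refl = here refl
    f-injective : Injective _≡_ _≡_ f
    f-injective {i} {j} fi≡fj with <-cmp i j
    ... | tri< i<j _ _ = ⊥-elim (proj₂ (proj₂ (fresh (chosen j))) (subst (_∈ chosen j) fi≡fj (chosen-before i<j)))
    ... | tri≈ _ i≡j _ = i≡j
    ... | tri> _ _ j<i = ⊥-elim (proj₂ (proj₂ (fresh (chosen i))) (subst (_∈ chosen i) (sym fi≡fj) (chosen-before j<i)))

CompleteTo : (G : Graph) → List (V G) → VSet G
CompleteTo G L z = ∀ a → a ∈ L → E G a z

module Graphs (G : Graph) where

  Conn-target : ∀ {P x y} → Conn G P x y → P y
  Conn-target (here py)     = py
  Conn-target (step _ _ py) = py

  Conn-source : ∀ {P x y} → Conn G P x y → P x
  Conn-source (here px)    = px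
  Conn-source (step c _ _) = Conn-source c

  Conn-trans : ∀ {P x y z} → Conn G P x y → Conn G P y z → Conn G P x z
  Conn-trans c (here _)      = c
  Conn-trans c (step d e pz) = step (Conn-trans c d) e pz

  Conn-cons : ∀ {P x y z} → P x → E G x y → Conn G P y z → Conn G P x z
  Conn-cons px e c = Conn-trans (step (here px) e (Conn-source c)) c

  Conn-sym : ∀ {P x y} → Conn G P x y → Conn G P y x
  Conn-sym (here px)     = here px
  Conn-sym (step c e pz) = Conn-cons pz (E-sym G e) (Conn-sym c)

  Conn-mono : ∀ {P Q : VSet G} {x y} → (∀ {z} → P z → Q z) → Conn G P x y → Conn G Q x y
  Conn-mono P⊆Q (here px)     = here (P⊆Q px)
  Conn-mono P⊆Q (step c e pz) = step (Conn-mono P⊆Q c) e (P⊆Q pz)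

  Conn-in-Comp : ∀ {S v x y} → Comp G S v x → Conn G (λ z → ¬ S z) x y → Conn G (Comp G S v) x y
  Conn-in-Comp vx (here _)       = here vx
  Conn-in-Comp vx (step c e ¬Sz) with Conn-in-Comp vx c
  ... | c′ = step c′ e (step (Conn-target c′) e ¬Sz)

  Comp-connected : ∀ {S v} → ¬ S v → IsConnectedSet G (Comp G S v)
  Comp-connected ¬Sv = _ , here ¬Sv , λ x y vx vy → Conn-in-Comp vx (Conn-trans (Conn-sym vx) vy)

  Comp-⊆ : ∀ {S B v} → ¬ S v → (∀ {y z} → Comp G S v y → E G y z → S z → B z) →
           ∀ {z} → Comp G B v z → Comp G S v z
  Comp-⊆ ¬Sv boundary (here _)       = here ¬Sv
  Comp-⊆ ¬Sv boundary (step c e ¬Bz) with Comp-⊆ ¬Sv boundary c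
  ... | vy = step vy e (λ Sz → ¬Bz (boundary vy e Sz))

  clique-mono : ∀ {P Q : VSet G} → (∀ {z} → P z → Q z) → IsClique G Q → IsClique G P
  clique-mono P⊆Q Q-clique x y px py = Q-clique x y (P⊆Q px) (P⊆Q py)

  ++-clique : ∀ {L K} → IsClique G (⟦_⟧ {G} L) → IsClique G (⟦_⟧ {G} K) →
              (∀ {x y} → x ∈ L → y ∈ K → E G x y) → IsClique G (⟦_⟧ {G} (L ++ K))
  ++-clique {L} L-clique K-clique L~K x y x∈ y∈ x≢y with ∈-++⁻ L x∈ | ∈-++⁻ L y∈
  ... | inj₁ x∈L | inj₁ y∈L = L-clique x y x∈L y∈L x≢y
  ... | inj₁ x∈L | inj₂ y∈K = L~K x∈L y∈K
  ... | inj₂ x∈K | inj₁ y∈L = E-sym G (L~K y∈L x∈K)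
  ... | inj₂ x∈K | inj₂ y∈K = K-clique x y x∈K y∈K x≢y

  singleton-clique : ∀ {v} → IsClique G (⟦_⟧ {G} (v ∷ []))
  singleton-clique x y (here refl) (here refl) x≢y = ⊥-elim (x≢y refl)

  complete⇒∉ : ∀ {L z} → CompleteTo G L z → z ∉ L
  complete⇒∉ complete z∈L = E-irrefl G (complete _ z∈L)

  𝓗-minor : ∀ {a D f} → IsConnectedSet G D → Injective _≡_ _≡_ f →
            ¬ D a → (∀ n → ¬ D (f n)) → (∀ {d} → D d → ¬ E G a d) →
            (∀ n → E G a (f n)) → (∀ {n m} → n ≢ m → E G (f n) (f m)) →
            (∀ n → Σ[ d ∈ V G ] D d × E G (f n) d) → HInducedMinor G
  𝓗-minor {a} {D} {f} D-connected f-injective ¬Da ¬Df a≁D a~f f-clique f~D = record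
    { branch = branch ; connected = connected ; disjoint = disjoint ; edges = edges }
    where
    branch : HV → VSet G
    branch (cl n) x = x ≡ f n
    branch top    x = x ≡ a
    branch bot    x = D x

    singleton-connected : ∀ u → IsConnectedSet G (_≡ u)
    singleton-connected u = u , refl , λ { _ _ refl refl → here refl }

    connected : ∀ h → IsConnectedSet G (branch h)
    connected (cl n) = singleton-connected (f n)
    connected top    = singleton-connected a
    connected bot    = D-connected

    f≢a : ∀ n → f n ≢ a
    f≢a n fn≡a = E-irrefl G (subst (E G a) fn≡a (a~f n))

    cl-injective : ∀ {n m} → cl n ≢ cl m → n ≢ m
    cl-injective cln≢clm refl = cln≢clm refl

    disjoint : ∀ h h′ → h ≢ h′ → ∀ x → branch h x → ¬ branch h′ x
    disjoint (cl n) (cl m) h≢h′ _ refl fn≡fm = cl-injective h≢h′ (f-injective fn≡fm)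
    disjoint (cl n) top    _    _ refl fn≡a  = f≢a n fn≡a
    disjoint (cl n) bot    _    _ refl Dfn   = ¬Df n Dfn
    disjoint top    (cl n) _    _ refl a≡fn  = f≢a n (sym a≡fn)
    disjoint top    top    h≢h′ _ _    _     = h≢h′ refl
    disjoint top    bot    _    _ refl Da    = ¬Da Da
    disjoint bot    (cl n) _    _ Dx   refl  = ¬Df n Dx
    disjoint bot    top    _    _ Dx   refl  = ¬Da Dx
    disjoint bot    bot    h≢h′ _ _    _     = h≢h′ refl

    edges : ∀ h h′ → h ≢ h′ → (Σ[ x ∈ V G ] Σ[ y ∈ V G ] (branch h x × branch h′ y × E G x y)) ⇔ HE h h′
    edges (cl n) (cl m) h≢h′ = mk⇔ (λ _ → cl-injective h≢h′) λ n≢m →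
      f n , f m , refl , refl , f-clique n≢m
    edges (cl n) top    _    = mk⇔ _ λ _ → f n , a , refl , refl , E-sym G (a~f n)
    edges (cl n) bot    _    = mk⇔ _ λ _ → f n , proj₁ (f~D n) , refl , proj₂ (f~D n)
    edges top    (cl n) _    = mk⇔ _ λ _ → a , f n , refl , refl , a~f n
    edges top    top    h≢h′ = ⊥-elim (h≢h′ refl)
    edges top    bot    _    = mk⇔ (λ { (_ , _ , refl , Dy , a~y) → a≁D Dy a~y }) λ ()
    edges bot    (cl n) _    = mk⇔ _ λ _ → proj₁ (f~D n) , f n , proj₁ (proj₂ (f~D n)) , refl ,
                                            E-sym G (proj₂ (proj₂ (f~D n)))
    edges bot    top    _    = mk⇔ (λ { (_ , _ , Dx , refl , x~a) → a≁D Dx (E-sym G x~a) }) λ ()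
    edges bot    bot    h≢h′ = ⊥-elim (h≢h′ refl)

  record IsWalk (P : VSet G) (x y : V G) (m : ℕ) (q : ℕ → V G) : Set where
    field
      start    : q 0 ≡ x
      end      : q m ≡ y
      inside   : ∀ {i} → i ≤ m → P (q i)
      adjacent : ∀ {i} → i < m → E G (q i) (q (suc i))
  open IsWalk public

  Walk : VSet G → V G → V G → ℕ → Set
  Walk P x y m = Σ[ q ∈ (ℕ → V G) ] IsWalk P x y m q

  join : (ℕ → V G) → ℕ → (ℕ → V G) → ℕ → V G
  join p zero    r zero    = p 0
  join p zero    r (suc k) = r k
  join p (suc a) r zero    = p 0
  join p (suc a) r (suc k) = join (p ∘ suc) a r k

  join-≤ : ∀ p a r {k} → k ≤ a → join p a r k ≡ p k
  join-≤ p zero    r z≤n       = refl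
  join-≤ p (suc a) r {zero}  _ = refl
  join-≤ p (suc a) r {suc k} (s≤s k≤a) = join-≤ (p ∘ suc) a r k≤a

  join-> : ∀ p a r {k} → a < k → join p a r k ≡ r (k ∸ suc a)
  join-> p zero    r {suc k} _         = refl
  join-> p (suc a) r {suc k} (s≤s a<k) = join-> (p ∘ suc) a r a<k

  trivial-walk : ∀ {P x} → P x → IsWalk P x x 0 (const x)
  trivial-walk px = record { start = refl ; end = refl ; inside = λ _ → px ; adjacent = λ () }

  walk-append : ∀ {P x u u′ y a b p r} → IsWalk P x u a p → E G u u′ → IsWalk P u′ y b r →
                IsWalk P x y (a + suc b) (join p a r)
  walk-append {P} {a = a} {b} {p} {r} W u~u′ W′ = record
    { start    = trans (join-≤ p a r z≤n) (start W)
    ; end      = trans (join-> p a r (m<m+n a z<s)) (trans (cong r a+1+b∸1+a≡b) (end W′))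
    ; inside   = inside′
    ; adjacent = adjacent′
    }
    where
    a+1+b∸1+a≡b : a + suc b ∸ suc a ≡ b
    a+1+b∸1+a≡b = trans (cong (_∸ suc a) (+-suc a b)) (m+n∸m≡n a b)

    beyond : ∀ {k} → k ≤ a + suc b → k ∸ suc a ≤ b
    beyond k≤ = subst (_ ≤_) a+1+b∸1+a≡b (∸-monoˡ-≤ (suc a) k≤)

    inside′ : ∀ {k} → k ≤ a + suc b → P (join p a r k)
    inside′ {k} k≤ with k ≤? a
    ... | yes k≤a = subst P (sym (join-≤ p a r k≤a)) (inside W k≤a)
    ... | no  k≰a = subst P (sym (join-> p a r (≰⇒> k≰a))) (inside W′ (beyond k≤))

    adjacent′ : ∀ {k} → k < a + suc b → E G (join p a r k) (join p a r (suc k))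
    adjacent′ {k} k< with <-cmp k a
    ... | tri< k<a _ _ = subst₂ (E G) (sym (join-≤ p a r (<⇒≤ k<a))) (sym (join-≤ p a r k<a)) (adjacent W k<a)
    ... | tri≈ _ refl _ = subst₂ (E G) (sym (trans (join-≤ p a r ≤-refl) (end W)))
                            (sym (trans (join-> p a r ≤-refl) (trans (cong r (n∸n≡0 a)) (start W′)))) u~u′
    ... | tri> _ _ a<k = subst₂ (E G) (sym (join-> p a r a<k))
                            (sym (trans (join-> p a r (m<n⇒m<1+n a<k)) (cong r (+-∸-assoc 1 a<k))))
                            (adjacent W′ (subst (_≤ b) (+-∸-assoc 1 a<k) (beyond k<)))

  walk-prefix : ∀ {P x y m q i} → IsWalk P x y m q → i ≤ m → IsWalk P x (q i) i q
  walk-prefix W i≤m = record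
    { start = start W ; end = refl
    ; inside = λ k≤i → inside W (≤-trans k≤i i≤m) ; adjacent = λ k<i → adjacent W (<-≤-trans k<i i≤m) }

  walk-suffix : ∀ {P x y m q j} → IsWalk P x y m q → j ≤ m → IsWalk P (q j) y (m ∸ j) (λ k → q (j + k))
  walk-suffix {m = m} {q} {j} W j≤m = record
    { start    = cong q (+-identityʳ j)
    ; end      = trans (cong q (m+[n∸m]≡n j≤m)) (end W)
    ; inside   = λ k≤ → inside W (shift k≤)
    ; adjacent = λ {k} k< → subst (E G (q (j + k)) ∘ q) (sym (+-suc j k))
                               (adjacent W (subst (_≤ m) (+-suc j k) (shift k<)))
    }
    where
    shift : ∀ {k} → k ≤ m ∸ j → j + k ≤ m
    shift k≤ = subst (_ ≤_) (m+[n∸m]≡n j≤m) (+-monoʳ-≤ j k≤)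

  Conn⇒Walk : ∀ {P x y} → Conn G P x y → Σ[ m ∈ ℕ ] Walk P x y m
  Conn⇒Walk (here px) = 0 , _ , trivial-walk px
  Conn⇒Walk (step c e pz) with Conn⇒Walk c
  ... | m , _ , W = m + 1 , _ , walk-append W e (trivial-walk pz)

  record IsInducedPath (P : VSet G) (x y : V G) (m : ℕ) (q : ℕ → V G) : Set where
    field
      walk      : IsWalk P x y m q
      injective : ∀ {i j} → i ≤ m → j ≤ m → q i ≡ q j → i ≡ j
      chordless : ∀ {i j} → i ≤ m → j ≤ m → E G (q i) (q j) → suc i ≡ j ⊎ suc j ≡ i
  open IsInducedPath public

  induced-prefix : ∀ {P x y m q i} → IsInducedPath P x y m q → i ≤ m → IsInducedPath P x (q i) i q
  induced-prefix I i≤m = record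
    { walk      = walk-prefix (walk I) i≤m
    ; injective = λ j≤i k≤i → injective I (≤-trans j≤i i≤m) (≤-trans k≤i i≤m)
    ; chordless = λ j≤i k≤i → chordless I (≤-trans j≤i i≤m) (≤-trans k≤i i≤m)
    }

  module _ {P x y m q} (W : IsWalk P x y m q) (shortest : ∀ {k} → k < m → ¬ Walk P x y k) where

    no-chord : ∀ {i j} → suc i < j → j ≤ m → ¬ E G (q i) (q j)
    no-chord {i} {j} 1+i<j j≤m qi~qj =
      shortest shorter (_ , walk-append (walk-prefix W i≤m) qi~qj (walk-suffix W j≤m))
      where
      i≤m : i ≤ m
      i≤m = <⇒≤ (<-≤-trans (<-trans (n<1+n i) 1+i<j) j≤m)
      shorter : i + suc (m ∸ j) < m
      shorter = subst₂ _<_ (sym (+-suc i (m ∸ j))) (m+[n∸m]≡n j≤m) (+-monoˡ-< (m ∸ j) 1+i<j)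

    no-repeat : ∀ {i j} → i < j → j ≤ m → q i ≢ q j
    no-repeat {i} {j} i<j j≤m qi≡qj with m≤n⇒m<n∨m≡n j≤m
    ... | inj₁ j<m  = no-chord (s≤s i<j) j<m (subst (λ u → E G u (q (suc j))) (sym qi≡qj) (adjacent W j<m))
    ... | inj₂ refl = shortest i<j (q , subst (λ z → IsWalk P x z i q) (trans qi≡qj (end W))
                                              (walk-prefix W (<⇒≤ i<j)))

    shortest⇒induced : IsInducedPath P x y m q
    shortest⇒induced = record { walk = W ; injective = injective′ ; chordless = chordless′ }
      where
      injective′ : ∀ {i j} → i ≤ m → j ≤ m → q i ≡ q j → i ≡ j
      injective′ {i} {j} i≤m j≤m qi≡qj with <-cmp i j
      ... | tri< i<j _ _ = ⊥-elim (no-repeat i<j j≤m qi≡qj)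
      ... | tri≈ _ i≡j _ = i≡j
      ... | tri> _ _ j<i = ⊥-elim (no-repeat j<i i≤m (sym qi≡qj))

      forward : ∀ {i j} → i < j → j ≤ m → E G (q i) (q j) → suc i ≡ j
      forward i<j j≤m qi~qj with m≤n⇒m<n∨m≡n i<j
      ... | inj₁ 1+i<j = ⊥-elim (no-chord 1+i<j j≤m qi~qj)
      ... | inj₂ 1+i≡j = 1+i≡j

      chordless′ : ∀ {i j} → i ≤ m → j ≤ m → E G (q i) (q j) → suc i ≡ j ⊎ suc j ≡ i
      chordless′ {i} {j} i≤m j≤m qi~qj with <-cmp i j
      ... | tri< i<j _ _  = inj₁ (forward i<j j≤m qi~qj)
      ... | tri≈ _ refl _ = ⊥-elim (E-irrefl G qi~qj)
      ... | tri> _ _ j<i  = inj₂ (forward j<i i≤m (E-sym G qi~qj))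

  induced-path : Classical → ∀ {P x y} → Conn G P x y → Σ[ m ∈ ℕ ] Σ[ q ∈ (ℕ → V G) ] IsInducedPath P x y m q
  induced-path lem {P} {x} {y} c with least-witness lem (Walk P x y) (proj₂ (Conn⇒Walk c))
  ... | m , (q , W) , shortest = m , q , shortest⇒induced W shortest

-- CycAdj n i j unfolds to CyclicallyAdjacent n (toℕ i) (toℕ j).
CyclicallyAdjacent : ℕ → ℕ → ℕ → Set
CyclicallyAdjacent n a b = (suc a ≡ b) ⊎ (suc b ≡ a) ⊎ (a ≡ 0 × suc b ≡ n) ⊎ (b ≡ 0 × suc a ≡ n)

CyclicallyAdjacent-sym : ∀ {n a b} → CyclicallyAdjacent n a b → CyclicallyAdjacent n b a
CyclicallyAdjacent-sym (inj₁ 1+a≡b)               = inj₂ (inj₁ 1+a≡b)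
CyclicallyAdjacent-sym (inj₂ (inj₁ 1+b≡a))        = inj₁ 1+b≡a
CyclicallyAdjacent-sym (inj₂ (inj₂ (inj₁ wraps))) = inj₂ (inj₂ (inj₂ wraps))
CyclicallyAdjacent-sym (inj₂ (inj₂ (inj₂ wraps))) = inj₂ (inj₂ (inj₁ wraps))

module Chordality (lem : Classical) {G : Graph} (chordal : Chordal G) where
  open Graphs G

  no-hole : ∀ n → 4 ≤ n → (g : ℕ → V G) → (∀ {a b} → a < n → b < n → g a ≡ g b → a ≡ b) →
            ¬ (∀ {a b} → a < n → b < n → E G (g a) (g b) ⇔ CyclicallyAdjacent n a b)
  no-hole n 4≤n g g-injective g-cycle = chordal n 4≤n (g ∘ toℕ)
    (λ {i} {k} gi≡gk → toℕ-injective (g-injective (toℕ<n i) (toℕ<n k) gi≡gk))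
    (λ i k → g-cycle (toℕ<n i) (toℕ<n k))

  module _ {P x y j q w} (I : IsInducedPath P x y j q) (w-off : ∀ {a} → a ≤ j → w ≢ q a)
           (w-ends : ∀ {a} → a ≤ j → E G w (q a) → a ≡ 0 ⊎ a ≡ j)
           (w~q₀ : E G w (q 0)) (w~qⱼ : E G w (q j)) where
    private
      n : ℕ
      n = suc (suc j)

      hole : ℕ → V G
      hole = join q j (const w)

      position : ∀ {a} → a < n → (a ≤ j × hole a ≡ q a) ⊎ (a ≡ suc j × hole a ≡ w)
      position a<n with m<1+n⇒m<n∨m≡n a<n
      ... | inj₁ a<1+j = inj₁ (≤-pred a<1+j , join-≤ q j (const w) (≤-pred a<1+j))
      ... | inj₂ refl  = inj₂ (refl , join-> q j (const w) ≤-refl)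

      1+a≢n : ∀ {a} → a ≤ j → ¬ suc a ≡ n
      1+a≢n a≤j refl = 1+n≰n a≤j

      path-cycle : ∀ {a b} → a ≤ j → b ≤ j → E G (q a) (q b) ⇔ CyclicallyAdjacent n a b
      path-cycle {a} {b} a≤j b≤j = mk⇔ (λ qa~qb → [ inj₁ , inj₂ ∘ inj₁ ]′ (chordless I a≤j b≤j qa~qb)) from
        where
        from : CyclicallyAdjacent n a b → E G (q a) (q b)
        from (inj₁ refl)                     = adjacent (walk I) b≤j
        from (inj₂ (inj₁ refl))              = E-sym G (adjacent (walk I) a≤j)
        from (inj₂ (inj₂ (inj₁ (_ , 1+b≡n)))) = ⊥-elim (1+a≢n b≤j 1+b≡n)
        from (inj₂ (inj₂ (inj₂ (_ , 1+a≡n)))) = ⊥-elim (1+a≢n a≤j 1+a≡n)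

      apex-cycle : ∀ a → a ≤ j → E G w (q a) ⇔ CyclicallyAdjacent n (suc j) a
      apex-cycle a a≤j = mk⇔ to from
        where
        to : E G w (q a) → CyclicallyAdjacent n (suc j) a
        to w~qa with w-ends a≤j w~qa
        ... | inj₁ refl = inj₂ (inj₂ (inj₂ (refl , refl)))
        ... | inj₂ refl = inj₂ (inj₁ refl)
        from : CyclicallyAdjacent n (suc j) a → E G w (q a)
        from (inj₁ refl)                    = ⊥-elim (1+n≰n (≤-trans (n≤1+n _) a≤j))
        from (inj₂ (inj₁ refl))             = w~qⱼ
        from (inj₂ (inj₂ (inj₁ (() , _))))
        from (inj₂ (inj₂ (inj₂ (refl , _)))) = w~q₀

      apex-irrefl : E G w w ⇔ CyclicallyAdjacent n (suc j) (suc j)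
      apex-irrefl = mk⇔ (⊥-elim ∘ E-irrefl G) from
        where
        from : CyclicallyAdjacent n (suc j) (suc j) → E G w w
        from (inj₁ 2+j≡1+j)                 = ⊥-elim (1+n≢n 2+j≡1+j)
        from (inj₂ (inj₁ 2+j≡1+j))          = ⊥-elim (1+n≢n 2+j≡1+j)
        from (inj₂ (inj₂ (inj₁ (() , _))))
        from (inj₂ (inj₂ (inj₂ (() , _))))

      hole-cycle : ∀ {a b} → a < n → b < n → E G (hole a) (hole b) ⇔ CyclicallyAdjacent n a b
      hole-cycle a<n b<n with position a<n | position b<n
      ... | inj₁ (a≤j , ha) | inj₁ (b≤j , hb) rewrite ha | hb = path-cycle a≤j b≤j
      ... | inj₁ (a≤j , ha) | inj₂ (refl , hb) rewrite ha | hb =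
        mk⇔ (CyclicallyAdjacent-sym ∘ Equivalence.to (apex-cycle _ a≤j) ∘ E-sym G)
            (E-sym G ∘ Equivalence.from (apex-cycle _ a≤j) ∘ CyclicallyAdjacent-sym)
      ... | inj₂ (refl , ha) | inj₁ (b≤j , hb) rewrite ha | hb = apex-cycle _ b≤j
      ... | inj₂ (refl , ha) | inj₂ (refl , hb) rewrite ha | hb = apex-irrefl

      hole-injective : ∀ {a b} → a < n → b < n → hole a ≡ hole b → a ≡ b
      hole-injective a<n b<n ha≡hb with position a<n | position b<n
      ... | inj₁ (a≤j , ha) | inj₁ (b≤j , hb) = injective I a≤j b≤j (trans (sym ha) (trans ha≡hb hb))
      ... | inj₁ (a≤j , ha) | inj₂ (refl , hb) = ⊥-elim (w-off a≤j (trans (sym hb) (trans (sym ha≡hb) ha)))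
      ... | inj₂ (refl , ha) | inj₁ (b≤j , hb) = ⊥-elim (w-off b≤j (trans (sym ha) (trans ha≡hb hb)))
      ... | inj₂ (refl , _)  | inj₂ (refl , _) = refl

    no-hole-over-apex : 2 ≤ j → ⊥
    no-hole-over-apex 2≤j = no-hole n (s≤s (s≤s 2≤j)) hole hole-injective hole-cycle

  apex-sees-second : ∀ {P x y m q w} → IsInducedPath P x y m q → 1 ≤ m → (∀ {i} → i ≤ m → w ≢ q i) →
                     E G w (q 0) → E G w (q m) → E G w (q 1)
  apex-sees-second {m = suc m} {q} {w} I (s≤s _) w-off w~q₀ w~qₘ
    with least-witness lem (λ k → E G w (q (suc k))) w~qₘ
  ... | zero  , w~q₁ , _       = w~q₁
  ... | suc k , w~qₖ , earlier =
    ⊥-elim (no-hole-over-apex (induced-prefix I 2+k≤m) (w-off ∘ λ i≤ → ≤-trans i≤ 2+k≤m)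
                              w-ends w~q₀ w~qₖ (s≤s (s≤s z≤n)))
    where
    2+k≤m : suc (suc k) ≤ suc m
    2+k≤m = s≤s (≮⇒≥ λ m<1+k → earlier m<1+k w~qₘ)
    w-ends : ∀ {a} → a ≤ suc (suc k) → E G w (q a) → a ≡ 0 ⊎ a ≡ suc (suc k)
    w-ends {zero}  _           _    = inj₁ refl
    w-ends {suc a} (s≤s a≤1+k) w~qa with m≤n⇒m<n∨m≡n a≤1+k
    ... | inj₁ a<1+k = ⊥-elim (earlier a<1+k w~qa)
    ... | inj₂ refl  = inj₂ refl

  neighbour-seeing-common-neighbours : ∀ {D : VSet G} {s t} → s ≢ t → ¬ E G s t →
    Conn G (λ z → D z ⊎ z ≡ s ⊎ z ≡ t) s t →
    Σ[ d ∈ V G ] D d × E G s d × (∀ {w} → ¬ D w → w ≢ s → w ≢ t → E G w s → E G w t → E G w d)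
  neighbour-seeing-common-neighbours {D} {s} {t} s≢t s≁t c with induced-path lem c
  ... | zero , q , I = ⊥-elim (s≢t (trans (sym (start (walk I))) (end (walk I))))
  ... | suc zero , q , I = ⊥-elim (s≁t (subst₂ (E G) (start (walk I)) (end (walk I)) (adjacent (walk I) ≤-refl)))
  ... | suc (suc m) , q , I = q 1 , Dq₁ , s~q₁ , sees
    where
    s~q₁ : E G s (q 1)
    s~q₁ = subst (λ u → E G u (q 1)) (start (walk I)) (adjacent (walk I) (s≤s z≤n))
    Dq₁ : D (q 1)
    Dq₁ with inside (walk I) (s≤s z≤n)
    ... | inj₁ Dq₁         = Dq₁
    ... | inj₂ (inj₁ refl) = ⊥-elim (E-irrefl G s~q₁)
    ... | inj₂ (inj₂ refl) = ⊥-elim (s≁t s~q₁)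
    sees : ∀ {w} → ¬ D w → w ≢ s → w ≢ t → E G w s → E G w t → E G w (q 1)
    sees {w} ¬Dw w≢s w≢t w~s w~t = apex-sees-second I (s≤s z≤n) w-off
      (subst (E G w) (sym (start (walk I))) w~s) (subst (E G w) (sym (end (walk I))) w~t)
      where
      w-off : ∀ {i} → i ≤ suc (suc m) → w ≢ q i
      w-off i≤ refl = [ ¬Dw , [ w≢s , w≢t ]′ ]′ (inside (walk I) i≤)

  common-neighbour : ∀ {D} → IsConnectedSet G D → (L : List (V G)) → IsClique G (⟦_⟧ {G} L) →
                     (∀ {a} → a ∈ L → ¬ D a) → (∀ {a} → a ∈ L → Σ[ d ∈ V G ] D d × E G a d) →
                     Σ[ d ∈ V G ] D d × CompleteTo G L d
  common-neighbour (d , Dd , _) [] _ _ _ = d , Dd , λ _ ()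
  common-neighbour {D} D-connected@(_ , _ , D-conn) (s ∷ L) clique outside attached
    with common-neighbour D-connected L (clique-mono there clique) (outside ∘ there) (attached ∘ there)
  ... | x , Dx , x-complete with lem (E G s x)
  ...   | yes s~x = x , Dx , λ { _ (here refl) → s~x ; a (there a∈L) → x-complete a a∈L }
  ...   | no s≁x with attached (here refl)
  ...     | sx , Dsx , s~sx with neighbour-seeing-common-neighbours {D} (λ { refl → outside (here refl) Dx }) s≁x
                                   (Conn-cons (inj₂ (inj₁ refl)) s~sx (Conn-mono inj₁ (D-conn _ _ Dsx Dx)))
  ...       | d , Dd , s~d , sees = d , Dd , λ
    { _ (here refl)   → s~d
    ; a (there a∈L) → sees (outside (there a∈L)) (a≢s a∈L) (a≢x a∈L) (a~s a∈L) (x-complete a a∈L) }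
    where
    a≢s : ∀ {a} → a ∈ L → a ≢ s
    a≢s a∈L refl = s≁x (x-complete _ a∈L)
    a≢x : ∀ {a} → a ∈ L → a ≢ x
    a≢x a∈L refl = outside (there a∈L) Dx
    a~s : ∀ {a} → a ∈ L → E G a s
    a~s a∈L = clique _ _ (there a∈L) (here refl) (a≢s a∈L)

Extension : (G : Graph) → List (V G) → V G → Set
Extension G A v = Σ[ B ∈ List (V G) ] ((∀ x → x ∈ A → x ∈ B) × IsClique G (⟦_⟧ {G} B) ×
                    (v ∈ B ⊎ Unattached G (Comp G (⟦_⟧ {G} B) v) (⟦_⟧ {G} A)))

module IncompleteVertex (lem : Classical) {G : Graph} (chordal : Chordal G) (no-𝓗 : ¬ HInducedMinor G)
  (A : List (V G)) (A-clique : IsClique G (⟦_⟧ {G} A))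
  (v : V G) (v∉A : v ∉ A) (v-incomplete : ¬ CompleteTo G A v) where
  open Graphs G
  open Chordality lem {G} chordal

  D : VSet G
  D = Comp G (λ z → z ∈ A ⊎ CompleteTo G A z) v

  S : VSet G
  S z = CompleteTo G A z × Σ[ d ∈ V G ] D d × E G z d

  D-connected : IsConnectedSet G D
  D-connected = Comp-connected [ v∉A , v-incomplete ]′

  D-outside-A : ∀ {z} → D z → z ∉ A
  D-outside-A Dz = Conn-target Dz ∘ inj₁

  D-incomplete : ∀ {z} → D z → ¬ CompleteTo G A z
  D-incomplete Dz = Conn-target Dz ∘ inj₂

  D-unattached : Σ[ a ∈ V G ] a ∈ A × (∀ {d} → D d → ¬ E G a d)
  D-unattached = decidable-stable (lem _) λ none →
    let d , Dd , d-complete = common-neighbour D-connected A A-clique (λ a∈A Da → D-outside-A Da a∈A)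
                                (λ {a} a∈A → decidable-stable (lem _) λ no-neighbour →
                                   none (a , a∈A , λ {d} Dd a~d → no-neighbour (_ , Dd , a~d)))
    in D-incomplete Dd d-complete

  S-clique : IsClique G S
  S-clique s t (s-complete , ds , Dds , s~ds) (t-complete , dt , Ddt , t~dt) s≢t with lem (E G s t)
  ... | yes s~t = s~t
  ... | no s≁t with neighbour-seeing-common-neighbours {D} s≢t s≁t
                      (Conn-cons (inj₂ (inj₁ refl)) s~ds
                        (step (Conn-mono inj₁ (proj₂ (proj₂ D-connected) _ _ Dds Ddt)) (E-sym G t~dt) (inj₂ (inj₂ refl))))
  ...   | d , Dd , _ , sees = ⊥-elim (D-incomplete Dd λ a a∈A →
          sees (λ Da → D-outside-A Da a∈A) (λ { refl → complete⇒∉ s-complete a∈A })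
               (λ { refl → complete⇒∉ t-complete a∈A }) (s-complete a a∈A) (t-complete a a∈A))

  a₀ : V G
  a₀ = proj₁ D-unattached

  a₀∈A : a₀ ∈ A
  a₀∈A = proj₁ (proj₂ D-unattached)

  a₀≁D : ∀ {d} → D d → ¬ E G a₀ d
  a₀≁D = proj₂ (proj₂ D-unattached)

  bounded-extension : (L : List (V G)) → (∀ {z} → S z → z ∈ L) → Extension G A v
  bounded-extension L S⊆L = A ++ F , (λ _ → ∈-++⁺ˡ) , B-clique , inj₂ (a₀ , a₀∈A , a₀-unattached)
    where
    S? : ∀ z → Dec (S z)
    S? z = lem (S z)
    F : List (V G)
    F = filter S? L
    F⊆S : ∀ {z} → z ∈ F → S z
    F⊆S z∈F = proj₂ (∈-filter⁻ S? {xs = L} z∈F)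
    B-clique : IsClique G (⟦_⟧ {G} (A ++ F))
    B-clique = ++-clique A-clique (clique-mono F⊆S S-clique) λ a∈A z∈F → proj₁ (F⊆S z∈F) _ a∈A
    boundary : ∀ {y z} → D y → E G y z → z ∈ A ⊎ CompleteTo G A z → z ∈ A ++ F
    boundary _  _   (inj₁ z∈A)      = ∈-++⁺ˡ z∈A
    boundary {z = z} Dy y~z (inj₂ z-complete) = ∈-++⁺ʳ A (∈-filter⁺ S? (S⊆L Sz) Sz)
      where
      Sz : S z
      Sz = z-complete , _ , Dy , E-sym G y~z
    a₀-unattached : ¬ Nbhd G (Comp G (⟦_⟧ {G} (A ++ F)) v) a₀
    a₀-unattached (_ , _ , vy , a₀~y) = a₀≁D (Comp-⊆ [ v∉A , v-incomplete ]′ boundary vy) a₀~y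

  unbounded-𝓗 : ¬ (Σ[ L ∈ List (V G) ] (∀ {z} → S z → z ∈ L)) → HInducedMinor G
  unbounded-𝓗 unbounded with injective-sequence lem S unbounded
  ... | _ , f∈S , f-injective = 𝓗-minor D-connected f-injective (λ Da → D-outside-A Da a₀∈A)
    (λ n Dfn → D-incomplete Dfn (proj₁ (f∈S n))) a₀≁D (λ n → proj₁ (f∈S n) a₀ a₀∈A)
    (λ n≢m → S-clique _ _ (f∈S _) (f∈S _) (n≢m ∘ f-injective)) (proj₂ ∘ f∈S)

  extension : Extension G A v
  extension with lem (Σ[ L ∈ List (V G) ] (∀ {z} → S z → z ∈ L))
  ... | yes (L , S⊆L) = bounded-extension L S⊆L
  ... | no unbounded  = ⊥-elim (no-𝓗 (unbounded-𝓗 unbounded))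

extension : Classical → (G : Graph) → Chordal G → ¬ HInducedMinor G → (A : List (V G)) → IsClique G (⟦_⟧ {G} A) →
            (v : V G) → v ∉ A → Extension G A v
extension lem G chordal no-𝓗 A A-clique v v∉A with lem (CompleteTo G A v)
... | yes v-complete = A ++ v ∷ [] , (λ _ → ∈-++⁺ˡ) ,
                       ++-clique A-clique singleton-clique (λ { a∈A (here refl) → v-complete _ a∈A }) ,
                       inj₁ (∈-++⁺ʳ A (here refl))
  where open Graphs G
... | no v-incomplete = IncompleteVertex.extension lem chordal no-𝓗 A A-clique v v∉A v-incomplete

lemma3p7 : Classical → (G : Graph) → Chordal G → ¬ HInducedMinor G →
    (A : List (V G)) → IsClique G (⟦_⟧ {G} A) →
    (c : V G) → c ∉ A → Attached G (Comp G (⟦_⟧ {G} A) c) (⟦_⟧ {G} A) →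
    (v : V G) → Comp G (⟦_⟧ {G} A) c v →
    Σ[ B ∈ List (V G) ] ((∀ x → x ∈ A → x ∈ B) × IsClique G (⟦_⟧ {G} B) ×
      (v ∈ B ⊎ Unattached G (Comp G (⟦_⟧ {G} B) v) (⟦_⟧ {G} A)))
lemma3p7 lem G chordal no-𝓗 A A-clique _ _ _ v Cv =
  extension lem G chordal no-𝓗 A A-clique v (Graphs.Conn-target G Cv)
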